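{- Let $\Gamma\cup\{\varphi\}$ be a set of formulas over the signature $\Sigma=\{\land,\lor,\to,\neg,\sim,\square\}$. If $\Gamma\vdash_{IvFDE_T}\varphi$, then $\Gamma\models_{IvFDE_T}\varphi$.
   Context: Formulas are built from a countable set of propositional variables using binary $\land,\lor,\to$ and unary $\neg$ (the paradefinite negation), $\sim$ (classical negation) and $\square$. Write $\alpha\leftrightarrow\beta$ for $(\alpha\to\beta)\land(\beta\to\alpha)$. Semantics. On $\{0,1\}$ let $\sqcap,\sqcup,\Rightarrow,\sim$ be the Boolean meet, join, implication and complement, with $0\le 1$. Let $B_T=\{z\in\{0,1\}^4: z_2\le z_1,\ z_1\sqcap z_3=0,\ z_2\sqcap z_4=0,\ z_3\le z_4\}$, whose six elements are $(1,1,0,0),(1,0,0,0),(1,0,0,1),(0,0,0,0),(0,0,0,1),(0,0,1,1)$. The designated set is $D=\{z\in B_T: z_1=1\}$. Each connective is interpreted by a multioperation returning a nonempty subset of $B_T$: - $z\tilde\land w=\{u\in B_T: u_1=z_1\sqcap w_1,\ u_2=z_2\sqcap w_2,\ u_4=z_4\sqcup w_4,\ z_3\sqcup w_3\le u_3\le (z_2\Rightarrow w_3)\sqcap(w_2\Rightarrow z_3)\}$; - $z\tilde\lor w=\{u\in B_T: u_1=z_1\sqcup w_1,\ u_3=z_3\sqcap w_3,\ u_4=z_4\sqcap w_4,\ z_2\sqcup w_2\le u_2\le (z_3\Rightarrow w_2)\sqcap(w_3\Rightarrow z_2)\}$; - $z\tilde\to w=\{u\in B_T: u_1=z_1\Rightarrow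 w_1,\ u_3=z_2\sqcap w_3,\ u_4=z_1\sqcap w_4,\ z_3\sqcup w_2\le u_2\le(z_2\Rightarrow w_2)\sqcap(w_3\Rightarrow z_3)\}$; - $\tilde\sim z=\{u\in B_T: u_1=\sim z_1,\ u_2=z_3,\ u_3=z_2,\ z_2\le u_4\le \sim z_3\}$; - $\tilde\neg z=\{(z_4,z_3,z_2,z_1)\}$; - $\tilde\square z=\{u\in B_T: u_1=z_2\}$. This is the non-deterministic matrix $\mathcal M_{IvFDE_T}$. A valuation is a map $v$ from formulas to $B_T$ with $v(\#(\varphi_1,\dots,\varphi_n))\in\tilde\#(v(\varphi_1),\dots,v(\varphi_n))$ for every connective $\#$. We write $\Gamma\models_{IvFDE_T}\varphi$ iff every valuation $v$ with $v(\gamma)\in D$ for all $\gamma\in\Gamma$ also has $v(\varphi)\in D$. Hilbert calculus $IvFDE_T$. The only rule is modus ponens: from $\varphi$ and $\varphi\to\psi$ infer $\psi$. The axiom schemas are: - (Ax1) $\varphi\to(\psi\to\varphi)$; - (Ax2) $(\varphi\to(\psi\to\gamma))\to((\varphi\to\psi)\to(\varphi\to\gamma))$; - (Ax3) $\varphi\to(\psi\to(\varphi\land\psi))$; - (Ax4) $(\varphi\land\psi)\to\varphi$; - (Ax5) $(\varphi\land\psi)\to\psi$; - (Ax6) $\varphi\to(\varphi\lor\psi)$; - (Ax7) $\psi\to(\varphi\lor\psi)$; - (Ax8) $(\varphi\to\gamma)\to((\psi\to\gamma)\to((\varphi\lor\psi)\to\gamma))$; - (DN) $\neg\neg\varphi\leftrightarrow\varphi$;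 - (DM1) $\neg(\varphi\lor\psi)\leftrightarrow(\neg\varphi\land\neg\psi)$; - (DM2) $\neg(\varphi\land\psi)\leftrightarrow(\neg\varphi\lor\neg\psi)$; - (DM3) $\neg(\varphi\to\psi)\leftrightarrow(\varphi\land\neg\psi)$; - (AxP) $\varphi\lor(\varphi\to\psi)$; - (Ax9) $(\sim\psi\to\sim\varphi)\to((\sim\psi\to\varphi)\to\psi)$; - (K) $\square(\varphi\to\psi)\to(\square\varphi\to\square\psi)$; - (K1) $\square(\varphi\to\psi)\to(\square\sim\psi\to\square\sim\varphi)$; - (K2) $\square\sim(\varphi\to\psi)\leftrightarrow(\square\varphi\land\square\sim\psi)$; - (M1) $(\square\sim\varphi\lor\square\psi)\to\square(\varphi\to\psi)$; - (T) $\square\varphi\to\varphi$; - (DN1) $\square\varphi\leftrightarrow\square\sim\sim\varphi$; - (N1) $\square(\varphi\land\psi)\leftrightarrow(\square\varphi\land\square\psi)$; - (N2) $\square\sim(\varphi\lor\psi)\leftrightarrow\square(\sim\varphi\land\sim\psi)$; - (N3) $(\square\sim\varphi\lor\square\sim\psi)\to\square\sim(\varphi\land\psi)$; - (N4) $(\square\varphi\lor\square\psi)\to\square(\varphi\lor\psi)$; - (N5) $\square\varphi\leftrightarrow\square\sim\neg\varphi$; - (N6) $\square\sim\varphi\leftrightarrow\square\sim\neg\neg\varphi$; - (N7) $\square\sim(\varphi\land\psi)\to(\square\varphi\to\square\sim\psi)$; - (N8) $\square\sim(\varphi\land\psi)\to(\square\psi\to\square\sim\varphi)$; - (N9) $\square(\varphi\lor\psi)\to(\square\sim\varphi\to\square\psi)$;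 - (N10) $\square(\varphi\lor\psi)\to(\square\sim\psi\to\square\varphi)$. $\Gamma\vdash_{IvFDE_T}\varphi$ means $\varphi$ is derivable from $\Gamma$ in this calculus. -}

module Defs where

open import Data.Nat using (ℕ)
open import Data.Bool using (Bool; true; false; _∧_; _∨_; not; _≤_)
open import Data.Product using (_×_)
open import Relation.Binary.PropositionalEquality using (_≡_)

infixr 5 _⇒_
infixr 6 _∨f_
infixr 7 _∧f_

data Formula : Set where
  var  : ℕ → Formula
  _∧f_ : Formula → Formula → Formula
  _∨f_ : Formula → Formula → Formula
  _⇒_  : Formula → Formula → Formula
  ¬f   : Formula → Formula          -- paradefinite negation ¬
  ∼f   : Formula → Formula          -- classical negation ∼
  □f   : Formula → Formula

_⇔_ : Formula → Formula → Formula
α ⇔ β = (α ⇒ β) ∧f (β ⇒ α)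

FSet : Set₁
FSet = Formula → Set

data Axiom : Formula → Set where
  ax1  : ∀ φ ψ → Axiom (φ ⇒ (ψ ⇒ φ))
  ax2  : ∀ φ ψ γ → Axiom ((φ ⇒ (ψ ⇒ γ)) ⇒ ((φ ⇒ ψ) ⇒ (φ ⇒ γ)))
  ax3  : ∀ φ ψ → Axiom (φ ⇒ (ψ ⇒ (φ ∧f ψ)))
  ax4  : ∀ φ ψ → Axiom ((φ ∧f ψ) ⇒ φ)
  ax5  : ∀ φ ψ → Axiom ((φ ∧f ψ) ⇒ ψ)
  ax6  : ∀ φ ψ → Axiom (φ ⇒ (φ ∨f ψ))
  ax7  : ∀ φ ψ → Axiom (ψ ⇒ (φ ∨f ψ))
  ax8  : ∀ φ ψ γ → Axiom ((φ ⇒ γ) ⇒ ((ψ ⇒ γ) ⇒ ((φ ∨f ψ) ⇒ γ)))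
  dn   : ∀ φ → Axiom (¬f (¬f φ) ⇔ φ)
  dm1  : ∀ φ ψ → Axiom (¬f (φ ∨f ψ) ⇔ (¬f φ ∧f ¬f ψ))
  dm2  : ∀ φ ψ → Axiom (¬f (φ ∧f ψ) ⇔ (¬f φ ∨f ¬f ψ))
  dm3  : ∀ φ ψ → Axiom (¬f (φ ⇒ ψ) ⇔ (φ ∧f ¬f ψ))
  axP  : ∀ φ ψ → Axiom (φ ∨f (φ ⇒ ψ))
  ax9  : ∀ φ ψ → Axiom ((∼f ψ ⇒ ∼f φ) ⇒ ((∼f ψ ⇒ φ) ⇒ ψ))
  axK  : ∀ φ ψ → Axiom (□f (φ ⇒ ψ) ⇒ (□f φ ⇒ □f ψ))
  axK1 : ∀ φ ψ → Axiom (□f (φ ⇒ ψ) ⇒ (□f (∼f ψ) ⇒ □f (∼f φ)))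
  axK2 : ∀ φ ψ → Axiom (□f (∼f (φ ⇒ ψ)) ⇔ (□f φ ∧f □f (∼f ψ)))
  axM1 : ∀ φ ψ → Axiom ((□f (∼f φ) ∨f □f ψ) ⇒ □f (φ ⇒ ψ))
  axT  : ∀ φ → Axiom (□f φ ⇒ φ)
  dn1  : ∀ φ → Axiom (□f φ ⇔ □f (∼f (∼f φ)))
  n1   : ∀ φ ψ → Axiom (□f (φ ∧f ψ) ⇔ (□f φ ∧f □f ψ))
  n2   : ∀ φ ψ → Axiom (□f (∼f (φ ∨f ψ)) ⇔ □f (∼f φ ∧f ∼f ψ))
  n3   : ∀ φ ψ → Axiom ((□f (∼f φ) ∨f □f (∼f ψ)) ⇒ □f (∼f (φ ∧f ψ)))
  n4   : ∀ φ ψ → Axiom ((□f φ ∨f □f ψ) ⇒ □f (φ ∨f ψ))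
  n5   : ∀ φ → Axiom (□f φ ⇔ □f (∼f (¬f φ)))
  n6   : ∀ φ → Axiom (□f (∼f φ) ⇔ □f (∼f (¬f (¬f φ))))
  n7   : ∀ φ ψ → Axiom (□f (∼f (φ ∧f ψ)) ⇒ (□f φ ⇒ □f (∼f ψ)))
  n8   : ∀ φ ψ → Axiom (□f (∼f (φ ∧f ψ)) ⇒ (□f ψ ⇒ □f (∼f φ)))
  n9   : ∀ φ ψ → Axiom (□f (φ ∨f ψ) ⇒ (□f (∼f φ) ⇒ □f ψ))
  n10  : ∀ φ ψ → Axiom (□f (φ ∨f ψ) ⇒ (□f (∼f ψ) ⇒ □f φ))

data _⊢_ (Γ : FSet) : Formula → Set where
  hyp : ∀ {φ} → Γ φ → Γ ⊢ φ
  ax  : ∀ {φ} → Axiom φ → Γ ⊢ φ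
  mp  : ∀ {φ ψ} → Γ ⊢ φ → Γ ⊢ (φ ⇒ ψ) → Γ ⊢ ψ

_⇒ᵇ_ : Bool → Bool → Bool
a ⇒ᵇ b = not a ∨ b

record BT : Set where
  constructor mkBT
  field
    z1 z2 z3 z4 : Bool
    c21 : z2 ≤ z1
    c13 : z1 ∧ z3 ≡ false
    c24 : z2 ∧ z4 ≡ false
    c34 : z3 ≤ z4
open BT public

Des : BT → Set
Des z = z1 z ≡ true

-- multioperations, given as membership predicates  u ∈ z ~# w
∧M : BT → BT → BT → Set
∧M z w u = (z1 u ≡ (z1 z ∧ z1 w)) × (z2 u ≡ (z2 z ∧ z2 w)) × (z4 u ≡ (z4 z ∨ z4 w))
         × ((z3 z ∨ z3 w) ≤ z3 u) × (z3 u ≤ ((z2 z ⇒ᵇ z3 w) ∧ (z2 w ⇒ᵇ z3 z)))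

∨M : BT → BT → BT → Set
∨M z w u = (z1 u ≡ (z1 z ∨ z1 w)) × (z3 u ≡ (z3 z ∧ z3 w)) × (z4 u ≡ (z4 z ∧ z4 w))
         × ((z2 z ∨ z2 w) ≤ z2 u) × (z2 u ≤ ((z3 z ⇒ᵇ z2 w) ∧ (z3 w ⇒ᵇ z2 z)))

⇒M : BT → BT → BT → Set
⇒M z w u = (z1 u ≡ (z1 z ⇒ᵇ z1 w)) × (z3 u ≡ (z2 z ∧ z3 w)) × (z4 u ≡ (z1 z ∧ z4 w))
         × ((z3 z ∨ z2 w) ≤ z2 u) × (z2 u ≤ ((z2 z ⇒ᵇ z2 w) ∧ (z3 w ⇒ᵇ z3 z)))

∼M : BT → BT → Set
∼M z u = (z1 u ≡ not (z1 z)) × (z2 u ≡ z3 z) × (z3 u ≡ z2 z)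
       × (z2 z ≤ z4 u) × (z4 u ≤ not (z3 z))

¬M : BT → BT → Set
¬M z u = (z1 u ≡ z4 z) × (z2 u ≡ z3 z) × (z3 u ≡ z2 z) × (z4 u ≡ z1 z)

□M : BT → BT → Set
□M z u = z1 u ≡ z2 z

record Valuation : Set where
  field
    v   : Formula → BT
    v∧  : ∀ φ ψ → ∧M (v φ) (v ψ) (v (φ ∧f ψ))
    v∨  : ∀ φ ψ → ∨M (v φ) (v ψ) (v (φ ∨f ψ))
    v⇒  : ∀ φ ψ → ⇒M (v φ) (v ψ) (v (φ ⇒ ψ))
    v¬  : ∀ φ → ¬M (v φ) (v (¬f φ))
    v∼  : ∀ φ → ∼M (v φ) (v (∼f φ))
    v□  : ∀ φ → □M (v φ) (v (□f φ))
open Valuation public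

_⊨_ : FSet → Formula → Set
Γ ⊨ φ = (val : Valuation) → (∀ γ → Γ γ → Des (v val γ)) → Des (v val φ)

-- The four coordinates of the value of φ record, respectively, whether φ, □φ, □∼φ and ¬φ
-- are designated.  Designation is classical and truth-functional on ∧, ∨, → and ∼, so every
-- axiom can be read as a Boolean formula in the coordinates of its immediate subformulas;
-- the restrictions imposed by the multioperations on those coordinates (the equations and
-- the lower and upper bounds) are exactly what makes each such formula a Boolean truth.
module Submission where

open import Data.Bool using (Bool; true; false; _∧_; _∨_; not; _≤_; b≤b)
open import Data.Bool.Properties using (≤-trans; ≤-minimum; ≤-maximum)
open import Data.Product using (_,_; proj₁; proj₂)
open import Relation.Binary.PropositionalEquality using (_≡_; refl; sym; trans; cong; cong₂)

open import Defs

⇒ᵇ-≤ : ∀ {a b} → a ≤ b → a ⇒ᵇ b ≡ true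
⇒ᵇ-≤ {false} _   = refl
⇒ᵇ-≤ {true} b≤b = refl

⇒ᵇ-mp : ∀ {a b} → a ⇒ᵇ b ≡ true → a ≡ true → b ≡ true
⇒ᵇ-mp a⇒b refl = a⇒b

≡⇒⇔ᵇ : ∀ {a b} → a ≡ b → (a ⇒ᵇ b) ∧ (b ⇒ᵇ a) ≡ true
≡⇒⇔ᵇ {false} refl = refl
≡⇒⇔ᵇ {true}  refl = refl

∧-≤ˡ : ∀ a b → a ∧ b ≤ a
∧-≤ˡ false _ = b≤b
∧-≤ˡ true  b = ≤-maximum b

∧-≤ʳ : ∀ a b → a ∧ b ≤ b
∧-≤ʳ false b = ≤-minimum b
∧-≤ʳ true  _ = b≤b

≤-∨ˡ : ∀ a b → a ≤ a ∨ b
≤-∨ˡ false b = ≤-minimum b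
≤-∨ˡ true  _ = b≤b

≤-∨ʳ : ∀ a b → b ≤ a ∨ b
≤-∨ʳ false _ = b≤b
≤-∨ʳ true  b = ≤-maximum b

⇒ᵇ-const : ∀ a b → a ⇒ᵇ (b ⇒ᵇ a) ≡ true
⇒ᵇ-const false _     = refl
⇒ᵇ-const true  false = refl
⇒ᵇ-const true  true  = refl

⇒ᵇ-distrib : ∀ a b c → (a ⇒ᵇ (b ⇒ᵇ c)) ⇒ᵇ ((a ⇒ᵇ b) ⇒ᵇ (a ⇒ᵇ c)) ≡ true
⇒ᵇ-distrib false _     _     = refl
⇒ᵇ-distrib true  false _     = refl
⇒ᵇ-distrib true  true  false = refl
⇒ᵇ-distrib true  true  true  = refl

⇒ᵇ-pair : ∀ a b → a ⇒ᵇ (b ⇒ᵇ (a ∧ b)) ≡ true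
⇒ᵇ-pair false _     = refl
⇒ᵇ-pair true  false = refl
⇒ᵇ-pair true  true  = refl

⇒ᵇ-∨-elim : ∀ a b c → (a ⇒ᵇ c) ⇒ᵇ ((b ⇒ᵇ c) ⇒ᵇ ((a ∨ b) ⇒ᵇ c)) ≡ true
⇒ᵇ-∨-elim false false _     = refl
⇒ᵇ-∨-elim false true  false = refl
⇒ᵇ-∨-elim false true  true  = refl
⇒ᵇ-∨-elim true  _     false = refl
⇒ᵇ-∨-elim true  false true  = refl
⇒ᵇ-∨-elim true  true  true  = refl

⇒ᵇ-excluded-middle : ∀ a b → a ∨ (a ⇒ᵇ b) ≡ true
⇒ᵇ-excluded-middle false _ = refl
⇒ᵇ-excluded-middle true  _ = refl

⇒ᵇ-reductio : ∀ a b → (not b ⇒ᵇ not a) ⇒ᵇ ((not b ⇒ᵇ a) ⇒ᵇ b) ≡ true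
⇒ᵇ-reductio _     true  = refl
⇒ᵇ-reductio false false = refl
⇒ᵇ-reductio true  false = refl

module Designation (val : Valuation) where

  V : Formula → BT
  V = v val

  ⟦_⟧ : Formula → Bool
  ⟦ φ ⟧ = z1 (V φ)

  -- Unfolds the classical connectives down to the ¬-, □- and variable subformulas, so that
  -- on an axiom schema it computes to a Boolean term in the readings of its schematic parts.
  ⟦_⟧ᶜ : Formula → Bool
  ⟦ φ ∧f ψ ⟧ᶜ = ⟦ φ ⟧ᶜ ∧ ⟦ ψ ⟧ᶜ
  ⟦ φ ∨f ψ ⟧ᶜ = ⟦ φ ⟧ᶜ ∨ ⟦ ψ ⟧ᶜ
  ⟦ φ ⇒ ψ ⟧ᶜ  = ⟦ φ ⟧ᶜ ⇒ᵇ ⟦ ψ ⟧ᶜ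
  ⟦ ∼f φ ⟧ᶜ   = not ⟦ φ ⟧ᶜ
  ⟦ var x ⟧ᶜ  = ⟦ var x ⟧
  ⟦ ¬f φ ⟧ᶜ   = ⟦ ¬f φ ⟧
  ⟦ □f φ ⟧ᶜ   = ⟦ □f φ ⟧

  ⟦⟧≡⟦⟧ᶜ : ∀ φ → ⟦ φ ⟧ ≡ ⟦ φ ⟧ᶜ
  ⟦⟧≡⟦⟧ᶜ (φ ∧f ψ) = trans (proj₁ (v∧ val φ ψ)) (cong₂ _∧_ (⟦⟧≡⟦⟧ᶜ φ) (⟦⟧≡⟦⟧ᶜ ψ))
  ⟦⟧≡⟦⟧ᶜ (φ ∨f ψ) = trans (proj₁ (v∨ val φ ψ)) (cong₂ _∨_ (⟦⟧≡⟦⟧ᶜ φ) (⟦⟧≡⟦⟧ᶜ ψ))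
  ⟦⟧≡⟦⟧ᶜ (φ ⇒ ψ)  = trans (proj₁ (v⇒ val φ ψ)) (cong₂ _⇒ᵇ_ (⟦⟧≡⟦⟧ᶜ φ) (⟦⟧≡⟦⟧ᶜ ψ))
  ⟦⟧≡⟦⟧ᶜ (∼f φ)   = trans (proj₁ (v∼ val φ)) (cong not (⟦⟧≡⟦⟧ᶜ φ))
  ⟦⟧≡⟦⟧ᶜ (var x)  = refl
  ⟦⟧≡⟦⟧ᶜ (¬f φ)   = refl
  ⟦⟧≡⟦⟧ᶜ (□f φ)   = refl

  ∼-z2 : ∀ φ → z2 (V (∼f φ)) ≡ z3 (V φ)
  ∼-z2 φ = proj₁ (proj₂ (v∼ val φ))

  ∼-z3 : ∀ φ → z3 (V (∼f φ)) ≡ z2 (V φ)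
  ∼-z3 φ = proj₁ (proj₂ (proj₂ (v∼ val φ)))

  ¬-z2 : ∀ φ → z2 (V (¬f φ)) ≡ z3 (V φ)
  ¬-z2 φ = proj₁ (proj₂ (v¬ val φ))

  ¬-z3 : ∀ φ → z3 (V (¬f φ)) ≡ z2 (V φ)
  ¬-z3 φ = proj₁ (proj₂ (proj₂ (v¬ val φ)))

  ¬-z4 : ∀ φ → z4 (V (¬f φ)) ≡ z1 (V φ)
  ¬-z4 φ = proj₂ (proj₂ (proj₂ (v¬ val φ)))

  ⟦¬⟧ : ∀ φ → ⟦ ¬f φ ⟧ ≡ z4 (V φ)
  ⟦¬⟧ φ = proj₁ (v¬ val φ)

  ⟦□⟧ : ∀ φ → ⟦ □f φ ⟧ ≡ z2 (V φ)
  ⟦□⟧ φ = v□ val φ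

  ⟦□∼⟧ : ∀ φ → ⟦ □f (∼f φ) ⟧ ≡ z3 (V φ)
  ⟦□∼⟧ φ = trans (⟦□⟧ (∼f φ)) (∼-z2 φ)

  axiom-valid : ∀ {φ} → Axiom φ → ⟦ φ ⟧ᶜ ≡ true
  axiom-valid (ax1 φ ψ)   = ⇒ᵇ-const ⟦ φ ⟧ᶜ ⟦ ψ ⟧ᶜ
  axiom-valid (ax2 φ ψ γ) = ⇒ᵇ-distrib ⟦ φ ⟧ᶜ ⟦ ψ ⟧ᶜ ⟦ γ ⟧ᶜ
  axiom-valid (ax3 φ ψ)   = ⇒ᵇ-pair ⟦ φ ⟧ᶜ ⟦ ψ ⟧ᶜ
  axiom-valid (ax4 φ ψ)   = ⇒ᵇ-≤ (∧-≤ˡ ⟦ φ ⟧ᶜ ⟦ ψ ⟧ᶜ)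
  axiom-valid (ax5 φ ψ)   = ⇒ᵇ-≤ (∧-≤ʳ ⟦ φ ⟧ᶜ ⟦ ψ ⟧ᶜ)
  axiom-valid (ax6 φ ψ)   = ⇒ᵇ-≤ (≤-∨ˡ ⟦ φ ⟧ᶜ ⟦ ψ ⟧ᶜ)
  axiom-valid (ax7 φ ψ)   = ⇒ᵇ-≤ (≤-∨ʳ ⟦ φ ⟧ᶜ ⟦ ψ ⟧ᶜ)
  axiom-valid (ax8 φ ψ γ) = ⇒ᵇ-∨-elim ⟦ φ ⟧ᶜ ⟦ ψ ⟧ᶜ ⟦ γ ⟧ᶜ
  axiom-valid (axP φ ψ)   = ⇒ᵇ-excluded-middle ⟦ φ ⟧ᶜ ⟦ ψ ⟧ᶜ
  axiom-valid (ax9 φ ψ)   = ⇒ᵇ-reductio ⟦ φ ⟧ᶜ ⟦ ψ ⟧ᶜ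
  axiom-valid (dn φ) rewrite ⟦¬⟧ (¬f φ) =
    ≡⇒⇔ᵇ (trans (¬-z4 φ) (⟦⟧≡⟦⟧ᶜ φ))
  axiom-valid (dm1 φ ψ) rewrite ⟦¬⟧ (φ ∨f ψ) | ⟦¬⟧ φ | ⟦¬⟧ ψ =
    let (_ , _ , z4∨ , _) = v∨ val φ ψ in ≡⇒⇔ᵇ z4∨
  axiom-valid (dm2 φ ψ) rewrite ⟦¬⟧ (φ ∧f ψ) | ⟦¬⟧ φ | ⟦¬⟧ ψ =
    let (_ , _ , z4∧ , _) = v∧ val φ ψ in ≡⇒⇔ᵇ z4∧
  axiom-valid (dm3 φ ψ) rewrite ⟦¬⟧ (φ ⇒ ψ) | ⟦¬⟧ ψ =
    let (_ , _ , z4⇒ , _) = v⇒ val φ ψ in ≡⇒⇔ᵇ (trans z4⇒ (cong (_∧ z4 (V ψ)) (⟦⟧≡⟦⟧ᶜ φ)))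
  axiom-valid (axK φ ψ) rewrite ⟦□⟧ (φ ⇒ ψ) | ⟦□⟧ φ | ⟦□⟧ ψ =
    let (_ , _ , _ , _ , upper) = v⇒ val φ ψ in ⇒ᵇ-≤ (≤-trans upper (∧-≤ˡ _ _))
  axiom-valid (axK1 φ ψ) rewrite ⟦□⟧ (φ ⇒ ψ) | ⟦□∼⟧ φ | ⟦□∼⟧ ψ =
    let (_ , _ , _ , _ , upper) = v⇒ val φ ψ in ⇒ᵇ-≤ (≤-trans upper (∧-≤ʳ _ _))
  axiom-valid (axK2 φ ψ) rewrite ⟦□∼⟧ (φ ⇒ ψ) | ⟦□⟧ φ | ⟦□∼⟧ ψ =
    let (_ , z3⇒ , _) = v⇒ val φ ψ in ≡⇒⇔ᵇ z3⇒
  axiom-valid (axM1 φ ψ) rewrite ⟦□∼⟧ φ | ⟦□⟧ ψ | ⟦□⟧ (φ ⇒ ψ) =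
    let (_ , _ , _ , lower , _) = v⇒ val φ ψ in ⇒ᵇ-≤ lower
  axiom-valid (axT φ) rewrite ⟦□⟧ φ | sym (⟦⟧≡⟦⟧ᶜ φ) = ⇒ᵇ-≤ (c21 (V φ))
  axiom-valid (dn1 φ) rewrite ⟦□⟧ φ | ⟦□∼⟧ (∼f φ) =
    ≡⇒⇔ᵇ (sym (∼-z3 φ))
  axiom-valid (n1 φ ψ) rewrite ⟦□⟧ (φ ∧f ψ) | ⟦□⟧ φ | ⟦□⟧ ψ =
    let (_ , z2∧ , _) = v∧ val φ ψ in ≡⇒⇔ᵇ z2∧
  axiom-valid (n2 φ ψ) rewrite ⟦□∼⟧ (φ ∨f ψ) | ⟦□⟧ (∼f φ ∧f ∼f ψ) =
    let (_ , z3∨ , _) = v∨ val φ ψ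
        (_ , z2∧ , _) = v∧ val (∼f φ) (∼f ψ)
    in ≡⇒⇔ᵇ (trans z3∨ (sym (trans z2∧ (cong₂ _∧_ (∼-z2 φ) (∼-z2 ψ)))))
  axiom-valid (n3 φ ψ) rewrite ⟦□∼⟧ φ | ⟦□∼⟧ ψ | ⟦□∼⟧ (φ ∧f ψ) =
    let (_ , _ , _ , lower , _) = v∧ val φ ψ in ⇒ᵇ-≤ lower
  axiom-valid (n4 φ ψ) rewrite ⟦□⟧ φ | ⟦□⟧ ψ | ⟦□⟧ (φ ∨f ψ) =
    let (_ , _ , _ , lower , _) = v∨ val φ ψ in ⇒ᵇ-≤ lower
  axiom-valid (n5 φ) rewrite ⟦□⟧ φ | ⟦□∼⟧ (¬f φ) =
    ≡⇒⇔ᵇ (sym (¬-z3 φ))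
  axiom-valid (n6 φ) rewrite ⟦□∼⟧ φ | ⟦□∼⟧ (¬f (¬f φ)) =
    ≡⇒⇔ᵇ (sym (trans (¬-z3 (¬f φ)) (¬-z2 φ)))
  axiom-valid (n7 φ ψ) rewrite ⟦□∼⟧ (φ ∧f ψ) | ⟦□⟧ φ | ⟦□∼⟧ ψ =
    let (_ , _ , _ , _ , upper) = v∧ val φ ψ in ⇒ᵇ-≤ (≤-trans upper (∧-≤ˡ _ _))
  axiom-valid (n8 φ ψ) rewrite ⟦□∼⟧ (φ ∧f ψ) | ⟦□⟧ ψ | ⟦□∼⟧ φ =
    let (_ , _ , _ , _ , upper) = v∧ val φ ψ in ⇒ᵇ-≤ (≤-trans upper (∧-≤ʳ _ _))
  axiom-valid (n9 φ ψ) rewrite ⟦□⟧ (φ ∨f ψ) | ⟦□∼⟧ φ | ⟦□⟧ ψ =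
    let (_ , _ , _ , _ , upper) = v∨ val φ ψ in ⇒ᵇ-≤ (≤-trans upper (∧-≤ˡ _ _))
  axiom-valid (n10 φ ψ) rewrite ⟦□⟧ (φ ∨f ψ) | ⟦□∼⟧ ψ | ⟦□⟧ φ =
    let (_ , _ , _ , _ , upper) = v∨ val φ ψ in ⇒ᵇ-≤ (≤-trans upper (∧-≤ʳ _ _))

  axiom-designated : ∀ {φ} → Axiom φ → Des (V φ)
  axiom-designated {φ} a = trans (⟦⟧≡⟦⟧ᶜ φ) (axiom-valid a)

  derivable-designated : ∀ {Γ φ} → Γ ⊢ φ → (∀ γ → Γ γ → Des (V γ)) → Des (V φ)
  derivable-designated (hyp γ∈Γ)   Γ-designated = Γ-designated _ γ∈Γ
  derivable-designated (ax a)      _            = axiom-designated a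
  derivable-designated (mp {φ} {ψ} ⊢φ ⊢φ⇒ψ) Γ-designated =
    ⇒ᵇ-mp (trans (sym (proj₁ (v⇒ val φ ψ))) (derivable-designated ⊢φ⇒ψ Γ-designated))
          (derivable-designated ⊢φ Γ-designated)

mainTheorem1 : (Γ : FSet) (φ : Formula) → Γ ⊢ φ → Γ ⊨ φ
mainTheorem1 Γ φ ⊢φ val = Designation.derivable-designated val ⊢φ
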